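{- Let $q$ be a prime power and let $G$ be a finite $q$-regular bipartite multigraph with bipartition $(U,V)$. Assume that each vertex $v\in V$ is assigned an arbitrary value $\alpha(v)\in\{0,1,\ldots,q-1\}$. If $\mathrm{pm}(G)\not\equiv 0 \pmod q$, then $G$ has a spanning subgraph $H$ such that $d_H(u)=1$ for each vertex $u\in U$, and $d_H(v)\not\equiv \alpha(v) \pmod q$ for each vertex $v\in V$.
   Context: Multigraphs may have multiple (parallel) edges; each parallel edge is a distinct edge. For a vertex $v$ of a multigraph $G$, $d_G(v)$ denotes its degree in $G$, counting multiple edges with multiplicity. $\mathrm{pm}(G)$ denotes the number of perfect matchings of $G$, where a perfect matching is a set of edges covering every vertex exactly once (so matchings using different parallel edges are counted as different). A spanning subgraph $H$ of $G$ has the same vertex set as $G$ and a subset of its edges. -}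

module Defs where

open import Data.Nat using (ℕ; suc; _^_; ∣_-_∣)
open import Data.Nat.Divisibility using (_∣_)
open import Data.Nat.Primality using (Prime)
open import Data.Fin using (Fin; zero; suc)
open import Data.Fin.Subset using (Subset; _∈_)
open import Data.Fin.Subset.Properties using (_∈?_)
open import Data.Fin.Properties using (_≟_)
open import Data.Bool using (Bool; true; false)
open import Data.Vec using (Vec; []; _∷_)
open import Data.List using (List; []; _∷_; length; filter; allFin; map; _++_)
open import Data.Product using (Σ; ∃; _×_; _,_)
open import Relation.Binary.PropositionalEquality using (_≡_)
open import Relation.Nullary.Decidable using (_×-dec_)
open import Data.Fin.Properties using (all?)
open import Data.Nat.Properties using () renaming (_≟_ to _≟ℕ_)

IsPrimePower : ℕ → Set
IsPrimePower q = Σ ℕ λ p → Σ ℕ λ k → Prime p × (q ≡ p ^ suc k)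

_≡_[mod_] : ℕ → ℕ → ℕ → Set
a ≡ b [mod q ] = q ∣ ∣ a - b ∣

-- A finite bipartite multigraph with parts U = Fin n, V = Fin m and
-- edge set Fin e; edge f joins uEnd f ∈ U with vEnd f ∈ V.
-- Parallel edges are distinct elements of Fin e.
record BipMultigraph (n m : ℕ) : Set where
  field
    e    : ℕ
    uEnd : Fin e → Fin n
    vEnd : Fin e → Fin m

open BipMultigraph public

degU : ∀ {n m} (G : BipMultigraph n m) → Subset (e G) → Fin n → ℕ
degU G H u = length (filter (λ f → (f ∈? H) ×-dec (uEnd G f ≟ u)) (allFin (e G)))

degV : ∀ {n m} (G : BipMultigraph n m) → Subset (e G) → Fin m → ℕ
degV G H v = length (filter (λ f → (f ∈? H) ×-dec (vEnd G f ≟ v)) (allFin (e G)))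

fullSet : (k : ℕ) → Subset k
fullSet ℕ.zero = []
fullSet (suc k) = true ∷ fullSet k

IsRegular : ∀ {n m} → BipMultigraph n m → ℕ → Set
IsRegular {n} {m} G q =
  ((u : Fin n) → degU G (fullSet (e G)) u ≡ q) × ((v : Fin m) → degV G (fullSet (e G)) v ≡ q)

allSubsets : (k : ℕ) → List (Subset k)
allSubsets ℕ.zero = [] ∷ []
allSubsets (suc k) = map (true ∷_) (allSubsets k) ++ map (false ∷_) (allSubsets k)

IsPerfectMatching : ∀ {n m} (G : BipMultigraph n m) → Subset (e G) → Set
IsPerfectMatching {n} {m} G H =
  ((u : Fin n) → degU G H u ≡ 1) × ((v : Fin m) → degV G H v ≡ 1)

isPM? : ∀ {n m} (G : BipMultigraph n m) (H : Subset (e G)) → Relation.Nullary.Decidable.Dec (IsPerfectMatching G H)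
isPM? G H = all? (λ u → degU G H u ≟ℕ 1) ×-dec all? (λ v → degV G H v ≟ℕ 1)

pm : ∀ {n m} → BipMultigraph n m → ℕ
pm G = length (filter (isPM? G) (allSubsets (e G)))

-- Sum, over the ways s of choosing one edge at each u ∈ U, the product over v ∈ V of
-- d_s(v) + (q − α(v)), where d_s(v) counts the u whose chosen edge ends at v.  Every u offers
-- deg(u) = q ≡ 0 (mod q) choices, and a product of at most |U| affine functions of the d_s
-- keeps its sum modulo q when the constants are dropped.  Regularity gives
-- |V| = |U| = Σ_v d_s(v), so ∏_v d_s(v) is 1 when s is a perfect matching and 0 otherwise:
-- the sum is pm(G) modulo q.  If no s avoided α, each product would have a factor divisible
-- by q, forcing q ∣ pm(G).

{-# OPTIONS --safe #-}
module Submission where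

open import Defs
open import Level using (Level)
open import Data.Nat using (ℕ; zero; suc; _+_; _*_; _∸_; _≤_; _<_; z≤n; NonZero; _%_; ∣_-_∣)
open import Data.Nat.Primality using (prime⇒nonZero)
open import Data.Nat.DivMod using (%-distribˡ-+; %-distribˡ-*; [m+kn]%n≡m%n)
open import Data.Nat.Divisibility
  using (_∣_; _∣?_; divides; n∣m⇒m%n≡0; m%n≡0⇒n∣m; 0∣⇒≡0; ∣m⇒∣m*n; ∣n⇒∣m*n; ∣m∣n⇒∣m+n; ∣m+n∣m⇒∣n; ∣-refl)
open import Data.Nat.Properties hiding (_≟_; suc-injective)
open import Algebra.Properties.CommutativeSemigroup +-commutativeSemigroup using () renaming (interchange to +-interchange)
open import Algebra.Properties.CommutativeSemigroup *-commutativeSemigroup using (x∙yz≈y∙xz)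
import Data.Nat.Properties as ℕ
open import Data.Bool using (true; false; if_then_else_)
open import Data.Fin using (Fin; zero; suc; toℕ)
open import Data.Fin.Properties using (_≟_; suc-injective; all?; ¬∀⟶∃¬; toℕ<n)
open import Data.List using (List; []; _∷_; length; filter; allFin; map; _++_; [_]; concatMap)
open import Data.List.Properties using (length-++; ++-assoc; length-map; map-tabulate; length-tabulate)
open import Data.List.Relation.Unary.All using (All; []; _∷_)
import Data.List.Relation.Unary.All as All
import Data.List.Relation.Unary.All.Properties as Allₚ
open import Data.Vec using ([]; _∷_; tabulate; lookup)
import Data.Vec as Vec
import Data.Vec.Properties as Vecₚ
open import Data.Vec.Functional using () renaming (_∷_ to _◂_)
open import Data.Fin.Subset using (Subset; _∈_)
open import Data.Fin.Subset.Properties using (_∈?_)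
import Data.Bool.Properties as Bool
import Data.List.Membership.Propositional as List
import Data.List.Membership.Propositional.Properties as Listₚ
open import Data.List.Relation.Unary.Any using (here; any?)
open import Function using (_∘_)
open import Data.Product using (Σ; ∃; _×_; _,_; proj₁; proj₂)
open import Data.Sum using (inj₁; inj₂)
open import Relation.Binary.PropositionalEquality hiding ([_])
open import Relation.Nullary using (Dec; yes; no; ¬_; ¬?; does; contradiction)
open import Relation.Nullary.Decidable using (_×-dec_; decidable-stable)
open import Relation.Unary using (Decidable)
open import Relation.Binary.Definitions using (DecidableEquality)
open ≡-Reasoning

private variable
  a b p : Level
  A : Set a
  B : Set b
  P Q : Set p

⟦_⟧ : Dec P → ℕ
⟦ d ⟧ = if does d then 1 else 0

⟦⟧-cong : (P → Q) → (Q → P) → (d : Dec P) (d′ : Dec Q) → ⟦ d ⟧ ≡ ⟦ d′ ⟧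
⟦⟧-cong f g (yes p) (yes q) = refl
⟦⟧-cong f g (yes p) (no ¬q) = contradiction (f p) ¬q
⟦⟧-cong f g (no ¬p) (yes q) = contradiction (g q) ¬p
⟦⟧-cong f g (no ¬p) (no ¬q) = refl

⟦×-dec⟧ : (d : Dec P) (d′ : Dec Q) → ⟦ d ×-dec d′ ⟧ ≡ ⟦ d ⟧ * ⟦ d′ ⟧
⟦×-dec⟧ (yes p) (yes q) = refl
⟦×-dec⟧ (yes p) (no ¬q) = refl
⟦×-dec⟧ (no ¬p) d′ = refl

⟦yes⟧ : (d : Dec P) → P → ⟦ d ⟧ ≡ 1
⟦yes⟧ (yes p) _ = refl
⟦yes⟧ (no ¬p) p = contradiction p ¬p

⟦no⟧ : (d : Dec P) → ¬ P → ⟦ d ⟧ ≡ 0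
⟦no⟧ (yes p) ¬p = contradiction p ¬p
⟦no⟧ (no _) _ = refl

sumOver : List A → (A → ℕ) → ℕ
sumOver [] f = 0
sumOver (x ∷ xs) f = f x + sumOver xs f

prodOver : List A → (A → ℕ) → ℕ
prodOver [] f = 1
prodOver (x ∷ xs) f = f x * prodOver xs f

sumFin : (k : ℕ) → (Fin k → ℕ) → ℕ
sumFin k = sumOver (allFin k)

prodFin : (k : ℕ) → (Fin k → ℕ) → ℕ
prodFin k = prodOver (allFin k)

sumOver-cong : (xs : List A) {f g : A → ℕ} → (∀ x → f x ≡ g x) → sumOver xs f ≡ sumOver xs g
sumOver-cong [] eq = refl
sumOver-cong (x ∷ xs) eq = cong₂ _+_ (eq x) (sumOver-cong xs eq)

sumOver-congᴬ : {R : A → Set p} (xs : List A) {f g : A → ℕ} →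
                All R xs → (∀ x → R x → f x ≡ g x) → sumOver xs f ≡ sumOver xs g
sumOver-congᴬ [] [] eq = refl
sumOver-congᴬ (x ∷ xs) (rx ∷ rxs) eq = cong₂ _+_ (eq x rx) (sumOver-congᴬ xs rxs eq)

prodOver-cong : (xs : List A) {f g : A → ℕ} → (∀ x → f x ≡ g x) → prodOver xs f ≡ prodOver xs g
prodOver-cong [] eq = refl
prodOver-cong (x ∷ xs) eq = cong₂ _*_ (eq x) (prodOver-cong xs eq)

sumOver-++ : (xs ys : List A) (f : A → ℕ) → sumOver (xs ++ ys) f ≡ sumOver xs f + sumOver ys f
sumOver-++ [] ys f = refl
sumOver-++ (x ∷ xs) ys f = trans (cong (f x +_) (sumOver-++ xs ys f)) (sym (+-assoc (f x) _ _))

sumOver-map : (g : A → B) (xs : List A) (f : B → ℕ) → sumOver (map g xs) f ≡ sumOver xs (λ x → f (g x))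
sumOver-map g [] f = refl
sumOver-map g (x ∷ xs) f = cong (f (g x) +_) (sumOver-map g xs f)

prodOver-map : (g : A → B) (xs : List A) (f : B → ℕ) → prodOver (map g xs) f ≡ prodOver xs (λ x → f (g x))
prodOver-map g [] f = refl
prodOver-map g (x ∷ xs) f = cong (f (g x) *_) (prodOver-map g xs f)

sumOver-+ : (xs : List A) (f g : A → ℕ) → sumOver xs (λ x → f x + g x) ≡ sumOver xs f + sumOver xs g
sumOver-+ [] f g = refl
sumOver-+ (x ∷ xs) f g = trans (cong (f x + g x +_) (sumOver-+ xs f g)) (+-interchange (f x) (g x) _ _)

sumOver-*ˡ : (xs : List A) (c : ℕ) (f : A → ℕ) → sumOver xs (λ x → c * f x) ≡ c * sumOver xs f
sumOver-*ˡ [] c f = sym (*-zeroʳ c)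
sumOver-*ˡ (x ∷ xs) c f = trans (cong (c * f x +_) (sumOver-*ˡ xs c f)) (sym (*-distribˡ-+ c (f x) _))

sumOver-*ʳ : (xs : List A) (c : ℕ) (f : A → ℕ) → sumOver xs (λ x → f x * c) ≡ sumOver xs f * c
sumOver-*ʳ xs c f = trans (sumOver-cong xs (λ x → *-comm (f x) c)) (trans (sumOver-*ˡ xs c f) (*-comm c _))

sumOver-const : (xs : List A) (c : ℕ) → sumOver xs (λ _ → c) ≡ length xs * c
sumOver-const [] c = refl
sumOver-const (x ∷ xs) c = cong (c +_) (sumOver-const xs c)

sumOver-zero : (xs : List A) → sumOver xs (λ _ → 0) ≡ 0
sumOver-zero xs = trans (sumOver-const xs 0) (*-zeroʳ (length xs))

prodOver-one : (xs : List A) → prodOver xs (λ _ → 1) ≡ 1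
prodOver-one [] = refl
prodOver-one (x ∷ xs) = trans (+-identityʳ _) (prodOver-one xs)

sumOver-swap : (xs : List A) (ys : List B) (f : A → B → ℕ) →
               sumOver xs (λ x → sumOver ys (f x)) ≡ sumOver ys (λ y → sumOver xs (λ x → f x y))
sumOver-swap [] ys f = sym (sumOver-zero ys)
sumOver-swap (x ∷ xs) ys f = trans (cong (sumOver ys (f x) +_) (sumOver-swap xs ys f)) (sym (sumOver-+ ys (f x) _))

sumOver-filter : {R : A → Set p} (R? : Decidable R) (xs : List A) (g : A → ℕ) →
                 sumOver (filter R? xs) g ≡ sumOver xs (λ x → ⟦ R? x ⟧ * g x)
sumOver-filter R? [] g = refl
sumOver-filter R? (x ∷ xs) g with R? x
... | yes _ = cong₂ _+_ (sym (+-identityʳ (g x))) (sumOver-filter R? xs g)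
... | no _ = sumOver-filter R? xs g

length-filter≡sumOver : {R : A → Set p} (R? : Decidable R) (xs : List A) →
                        length (filter R? xs) ≡ sumOver xs (λ x → ⟦ R? x ⟧)
length-filter≡sumOver R? xs = begin
  length (filter R? xs)               ≡⟨ sym (trans (sumOver-const (filter R? xs) 1) (*-identityʳ _)) ⟩
  sumOver (filter R? xs) (λ _ → 1)    ≡⟨ sumOver-filter R? xs (λ _ → 1) ⟩
  sumOver xs (λ x → ⟦ R? x ⟧ * 1)     ≡⟨ sumOver-cong xs (λ x → *-identityʳ _) ⟩
  sumOver xs (λ x → ⟦ R? x ⟧)         ∎

allFin-suc : (k : ℕ) → allFin (suc k) ≡ zero ∷ map suc (allFin k)
allFin-suc k = cong (zero ∷_) (sym (map-tabulate (λ i → i) suc))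

sumFin-const : (k c : ℕ) → sumFin k (λ _ → c) ≡ k * c
sumFin-const k c = trans (sumOver-const (allFin k) c) (cong (_* c) (length-tabulate {n = k} (λ i → i)))

sumFin-suc : (k : ℕ) (f : Fin (suc k) → ℕ) → sumFin (suc k) f ≡ f zero + sumFin k (λ i → f (suc i))
sumFin-suc k f = trans (cong (λ xs → sumOver xs f) (allFin-suc k)) (cong (f zero +_) (sumOver-map suc (allFin k) f))

prodFin-suc : (k : ℕ) (f : Fin (suc k) → ℕ) → prodFin (suc k) f ≡ f zero * prodFin k (λ i → f (suc i))
prodFin-suc k f = trans (cong (λ xs → prodOver xs f) (allFin-suc k)) (cong (f zero *_) (prodOver-map suc (allFin k) f))

sumFin-select : (k : ℕ) (a : Fin k) (g : Fin k → ℕ) → sumFin k (λ x → ⟦ x ≟ a ⟧ * g x) ≡ g a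
sumFin-select (suc k) zero g = begin
  sumFin (suc k) (λ x → ⟦ x ≟ zero ⟧ * g x)                ≡⟨ sumFin-suc k (λ x → ⟦ x ≟ zero ⟧ * g x) ⟩
  g zero + 0 + sumFin k (λ x → ⟦ suc x ≟ zero ⟧ * g (suc x)) ≡⟨ cong (g zero + 0 +_) (sumOver-zero (allFin k)) ⟩
  g zero + 0 + 0                                            ≡⟨ trans (+-identityʳ _) (+-identityʳ _) ⟩
  g zero                                                    ∎
sumFin-select (suc k) (suc a) g = begin
  sumFin (suc k) (λ x → ⟦ x ≟ suc a ⟧ * g x)          ≡⟨ sumFin-suc k (λ x → ⟦ x ≟ suc a ⟧ * g x) ⟩
  sumFin k (λ x → ⟦ suc x ≟ suc a ⟧ * g (suc x))      ≡⟨ sumOver-cong (allFin k) (λ x → cong (_* g (suc x)) (suc≟suc x)) ⟩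
  sumFin k (λ x → ⟦ x ≟ a ⟧ * g (suc x))              ≡⟨ sumFin-select k a (λ x → g (suc x)) ⟩
  g (suc a)                                           ∎
  where
  suc≟suc : ∀ x → ⟦ suc x ≟ suc a ⟧ ≡ ⟦ x ≟ a ⟧
  suc≟suc x = ⟦⟧-cong suc-injective (cong suc) (suc x ≟ suc a) (x ≟ a)

sumFin-select′ : (k : ℕ) (a : Fin k) (g : Fin k → ℕ) → sumFin k (λ x → ⟦ a ≟ x ⟧ * g x) ≡ g a
sumFin-select′ k a g =
  trans (sumOver-cong (allFin k) (λ x → cong (_* g x) (⟦⟧-cong sym sym (a ≟ x) (x ≟ a)))) (sumFin-select k a g)

sumFin-⟦≟⟧ : (k : ℕ) (a : Fin k) → sumFin k (λ x → ⟦ a ≟ x ⟧) ≡ 1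
sumFin-⟦≟⟧ k a = trans (sumOver-cong (allFin k) (λ x → sym (*-identityʳ _))) (sumFin-select′ k a (λ _ → 1))

prodOver-++-∷ : (R : List A) (y : A) (T : List A) (f : A → ℕ) →
                prodOver (R ++ y ∷ T) f ≡ f y * prodOver (R ++ T) f
prodOver-++-∷ [] y T f = refl
prodOver-++-∷ (r ∷ R) y T f = trans (cong (f r *_) (prodOver-++-∷ R y T f)) (x∙yz≈y∙xz (f r) (f y) _)

sumOver-concatMap : (g : A → List B) (xs : List A) (f : B → ℕ) →
                    sumOver (concatMap g xs) f ≡ sumOver xs (λ x → sumOver (g x) f)
sumOver-concatMap g [] f = refl
sumOver-concatMap g (x ∷ xs) f = trans (sumOver-++ (g x) (concatMap g xs) f) (cong (sumOver (g x) f +_) (sumOver-concatMap g xs f))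

sumFin-fibres : ∀ {a} k (g : Fin a → Fin k) → sumFin k (λ x → sumFin a (λ f → ⟦ g f ≟ x ⟧)) ≡ a
sumFin-fibres {a} k g = begin
  sumFin k (λ x → sumFin a (λ f → ⟦ g f ≟ x ⟧))  ≡⟨ sumOver-swap (allFin k) (allFin a) _ ⟩
  sumFin a (λ f → sumFin k (λ x → ⟦ g f ≟ x ⟧))  ≡⟨ sumOver-cong (allFin a) (λ f → sumFin-⟦≟⟧ k (g f)) ⟩
  sumFin a (λ _ → 1)                             ≡⟨ sumFin-const a 1 ⟩
  a * 1                                          ≡⟨ *-identityʳ a ⟩
  a                                              ∎

sumOver-reindex : {R : A → Set p} (R? : Decidable R) (_≟ᴬ_ : DecidableEquality A)
                  (xs : List A) (ys : List B) (g : B → A) (F : A → ℕ) →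
                  (∀ x → R x → sumOver ys (λ y → ⟦ x ≟ᴬ g y ⟧) ≡ 1) →
                  All (λ y → R (g y) × sumOver xs (λ x → ⟦ x ≟ᴬ g y ⟧) ≡ 1) ys →
                  sumOver xs (λ x → ⟦ R? x ⟧ * F x) ≡ sumOver ys (F ∘ g)
sumOver-reindex {R = R} R? _≟ᴬ_ xs ys g F hit-once image = begin
  sumOver xs (λ x → ⟦ R? x ⟧ * F x)
    ≡⟨ sumOver-cong xs spread ⟩
  sumOver xs (λ x → sumOver ys (λ y → ⟦ R? x ⟧ * F x * ⟦ x ≟ᴬ g y ⟧))
    ≡⟨ sumOver-swap xs ys _ ⟩
  sumOver ys (λ y → sumOver xs (λ x → ⟦ R? x ⟧ * F x * ⟦ x ≟ᴬ g y ⟧))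
    ≡⟨ sumOver-congᴬ ys image collect ⟩
  sumOver ys (F ∘ g) ∎
  where
  spread : ∀ x → ⟦ R? x ⟧ * F x ≡ sumOver ys (λ y → ⟦ R? x ⟧ * F x * ⟦ x ≟ᴬ g y ⟧)
  spread x with R? x
  ... | yes r = sym (trans (sumOver-*ˡ ys (1 * F x) _) (trans (cong (1 * F x *_) (hit-once x r)) (*-identityʳ _)))
  ... | no _ = sym (sumOver-zero ys)

  pick : ∀ y → R (g y) → ∀ x → ⟦ R? x ⟧ * F x * ⟦ x ≟ᴬ g y ⟧ ≡ F (g y) * ⟦ x ≟ᴬ g y ⟧
  pick y r x with x ≟ᴬ g y
  ... | yes refl = trans (cong (λ t → t * F x * 1) (⟦yes⟧ (R? x) r)) (cong (_* 1) (+-identityʳ (F x)))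
  ... | no _ = trans (*-zeroʳ (⟦ R? x ⟧ * F x)) (sym (*-zeroʳ (F (g y))))

  collect : ∀ y → R (g y) × sumOver xs (λ x → ⟦ x ≟ᴬ g y ⟧) ≡ 1 →
            sumOver xs (λ x → ⟦ R? x ⟧ * F x * ⟦ x ≟ᴬ g y ⟧) ≡ F (g y)
  collect y (r , once) = begin
    sumOver xs (λ x → ⟦ R? x ⟧ * F x * ⟦ x ≟ᴬ g y ⟧) ≡⟨ sumOver-cong xs (pick y r) ⟩
    sumOver xs (λ x → F (g y) * ⟦ x ≟ᴬ g y ⟧)         ≡⟨ sumOver-*ˡ xs (F (g y)) _ ⟩
    F (g y) * sumOver xs (λ x → ⟦ x ≟ᴬ g y ⟧)         ≡⟨ cong (F (g y) *_) once ⟩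
    F (g y) * 1                                       ≡⟨ *-identityʳ _ ⟩
    F (g y)                                           ∎

∣-sumOver : ∀ {d} (xs : List A) (f : A → ℕ) → All (λ x → d ∣ f x) xs → d ∣ sumOver xs f
∣-sumOver [] f [] = divides 0 refl
∣-sumOver (x ∷ xs) f (d∣fx ∷ d∣fxs) = ∣m∣n⇒∣m+n d∣fx (∣-sumOver xs f d∣fxs)

∣-prodFin : ∀ {d} k (f : Fin k → ℕ) (j : Fin k) → d ∣ f j → d ∣ prodFin k f
∣-prodFin {d} (suc k) f zero d∣fj = subst (d ∣_) (sym (prodFin-suc k f)) (∣m⇒∣m*n _ d∣fj)
∣-prodFin {d} (suc k) f (suc j) d∣fj = subst (d ∣_) (sym (prodFin-suc k f)) (∣n⇒∣m*n (f zero) (∣-prodFin k (f ∘ suc) j d∣fj))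

prodFin-⟦⟧ : ∀ k {R : Fin k → Set p} (R? : Decidable R) → prodFin k (λ i → ⟦ R? i ⟧) ≡ ⟦ all? R? ⟧
prodFin-⟦⟧ zero R? with all? R?
... | yes _ = refl
... | no ¬all = contradiction (λ ()) ¬all
prodFin-⟦⟧ (suc k) {R} R? = begin
  prodFin (suc k) (λ i → ⟦ R? i ⟧)                     ≡⟨ prodFin-suc k (λ i → ⟦ R? i ⟧) ⟩
  ⟦ R? zero ⟧ * prodFin k (λ i → ⟦ R? (suc i) ⟧)       ≡⟨ cong (⟦ R? zero ⟧ *_) (prodFin-⟦⟧ k (R? ∘ suc)) ⟩
  ⟦ R? zero ⟧ * ⟦ all? (R? ∘ suc) ⟧                    ≡⟨ sym (⟦×-dec⟧ (R? zero) (all? (R? ∘ suc))) ⟩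
  ⟦ R? zero ×-dec all? (R? ∘ suc) ⟧                    ≡⟨ ⟦⟧-cong cons uncons (R? zero ×-dec all? (R? ∘ suc)) (all? R?) ⟩
  ⟦ all? R? ⟧                                          ∎
  where
  cons : R zero × (∀ i → R (suc i)) → ∀ i → R i
  cons (r₀ , rs) zero = r₀
  cons (r₀ , rs) (suc i) = rs i
  uncons : (∀ i → R i) → R zero × (∀ i → R (suc i))
  uncons rs = rs zero , rs ∘ suc

size≤sumFin : ∀ k (f : Fin k → ℕ) → (∀ i → 1 ≤ f i) → k ≤ sumFin k f
size≤sumFin zero f pos = z≤n
size≤sumFin (suc k) f pos =
  subst (suc k ≤_) (sym (sumFin-suc k f)) (+-mono-≤ (pos zero) (size≤sumFin k (f ∘ suc) (pos ∘ suc)))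

sumFin≡size⇒all≡1 : ∀ k (f : Fin k → ℕ) → (∀ i → 1 ≤ f i) → sumFin k f ≡ k → ∀ i → f i ≡ 1
sumFin≡size⇒all≡1 (suc k) f pos sum≡ = λ
  { zero → f₀≡1
  ; (suc i) → sumFin≡size⇒all≡1 k (f ∘ suc) (pos ∘ suc) rest≡k i }
  where
  rest = sumFin k (f ∘ suc)
  split : f zero + rest ≡ 1 + k
  split = trans (sym (sumFin-suc k f)) sum≡
  f₀≡1 : f zero ≡ 1
  f₀≡1 = ≤-antisym (+-cancelʳ-≤ k (f zero) 1 (≤-trans (+-monoʳ-≤ (f zero) (size≤sumFin k (f ∘ suc) (pos ∘ suc)))
                                                      (≤-reflexive split)))
                   (pos zero)
  rest≡k : rest ≡ k
  rest≡k = +-cancelˡ-≡ 1 rest k (trans (cong (_+ rest) (sym f₀≡1)) split)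

prodFin≡⟦all≡1⟧ : ∀ k (f : Fin k → ℕ) → sumFin k f ≡ k → prodFin k f ≡ ⟦ all? (λ i → f i ℕ.≟ 1) ⟧
prodFin≡⟦all≡1⟧ k f sum≡k with all? (λ i → f i ℕ.≟ 1)
... | yes all≡1 = trans (prodOver-cong (allFin k) all≡1)
                        (trans (prodOver-one (allFin k)) (sym (⟦yes⟧ (all? (λ i → f i ℕ.≟ 1)) all≡1)))
... | no ¬all≡1
  with ¬∀⟶∃¬ k (λ i → 1 ≤ f i) (λ i → 1 ℕ.≤? f i) (λ pos → ¬all≡1 (sumFin≡size⇒all≡1 k f pos sum≡k))
...   | j , fj≱1 = trans (0∣⇒≡0 (∣-prodFin k f j (subst (0 ∣_) (sym (n<1⇒n≡0 (≰⇒> fj≱1))) (divides 0 refl))))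
                         (sym (⟦no⟧ (all? (λ i → f i ℕ.≟ 1)) ¬all≡1))

module Modulo (q : ℕ) .{{_ : NonZero q}} where

  infix 4 _≈_
  _≈_ : ℕ → ℕ → Set
  a ≈ b = a % q ≡ b % q

  ≈-+ : ∀ {a b c d} → a ≈ b → c ≈ d → a + c ≈ b + d
  ≈-+ {a} {b} {c} {d} a≈b c≈d = begin
    (a + c) % q             ≡⟨ %-distribˡ-+ a c q ⟩
    (a % q + c % q) % q     ≡⟨ cong₂ (λ x y → (x + y) % q) a≈b c≈d ⟩
    (b % q + d % q) % q     ≡⟨ sym (%-distribˡ-+ b d q) ⟩
    (b + d) % q             ∎

  +-*-∣-≈ : ∀ a c {b} → q ∣ b → a + c * b ≈ a
  +-*-∣-≈ a c (divides k refl) = trans (cong (λ x → (a + x) % q) (sym (*-assoc c k q))) ([m+kn]%n≡m%n a (c * k) q)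

  ∣-resp-≈ : ∀ {a b} → a ≈ b → q ∣ b → q ∣ a
  ∣-resp-≈ {a} {b} a≈b q∣b = m%n≡0⇒n∣m a q (trans a≈b (n∣m⇒m%n≡0 b q q∣b))

  sumOver-≈ : (xs : List A) {f g : A → ℕ} → (∀ x → f x ≈ g x) → sumOver xs f ≈ sumOver xs g
  sumOver-≈ [] eq = refl
  sumOver-≈ (x ∷ xs) eq = ≈-+ (eq x) (sumOver-≈ xs eq)

∣+∸⇐≡[mod] : ∀ {q} L a → a < q → L ≡ a [mod q ] → q ∣ L + (q ∸ a)
∣+∸⇐≡[mod] {q} L a a<q q∣∣L-a∣ with ≤-<-connex a L
... | inj₁ a≤L = subst (q ∣_) L∸a+q≡ (∣m∣n⇒∣m+n (subst (q ∣_) (m≤n⇒∣n-m∣≡n∸m a≤L) q∣∣L-a∣) (∣-refl {q}))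
  where
  L∸a+q≡ : L ∸ a + q ≡ L + (q ∸ a)
  L∸a+q≡ = trans (sym (+-∸-comm q a≤L)) (+-∸-assoc L (<⇒≤ a<q))
... | inj₂ L<a = ∣m+n∣m⇒∣n (subst (q ∣_) (sym a∸L+[L+[q∸a]]≡q) (∣-refl {q}))
                           (subst (q ∣_) (m≤n⇒∣m-n∣≡n∸m (<⇒≤ L<a)) q∣∣L-a∣)
  where
  a∸L+[L+[q∸a]]≡q : a ∸ L + (L + (q ∸ a)) ≡ q
  a∸L+[L+[q∸a]]≡q = trans (sym (+-assoc (a ∸ L) L _))
                          (trans (cong (_+ (q ∸ a)) (m∸n+n≡m (<⇒≤ L<a))) (m+[n∸m]≡n (<⇒≤ a<q)))

module _ {X : Set} where

  choices : (n : ℕ) → (Fin n → List X) → List (Fin n → X)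
  choices zero O = [ (λ ()) ]
  choices (suc n) O = concatMap (λ x → map (x ◂_) (choices n (O ∘ suc))) (O zero)

  sumOver-choices-suc : ∀ {n} (O : Fin (suc n) → List X) (F : (Fin (suc n) → X) → ℕ) →
                        sumOver (choices (suc n) O) F ≡ sumOver (O zero) (λ x → sumOver (choices n (O ∘ suc)) (λ s → F (x ◂ s)))
  sumOver-choices-suc {n} O F =
    trans (sumOver-concatMap _ (O zero) F) (sumOver-cong (O zero) (λ x → sumOver-map (x ◂_) (choices n (O ∘ suc)) F))

  All-choices : ∀ n (O : Fin n → List X) {R : Fin n → X → Set p} →
                (∀ u → All (R u) (O u)) → All (λ s → ∀ u → R u (s u)) (choices n O)
  All-choices zero O h = (λ ()) ∷ []
  All-choices (suc n) O {R} h = Allₚ.concat⁺ (Allₚ.map⁺ (All.map extend (h zero)))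
    where
    extend : ∀ {x} → R zero x → All (λ s → ∀ u → R u (s u)) (map (x ◂_) (choices n (O ∘ suc)))
    extend rx = Allₚ.map⁺ (All.map (λ hs → λ { zero → rx ; (suc u) → hs u }) (All-choices n (O ∘ suc) (h ∘ suc)))

  sumOver-choices-prodFin : ∀ n (O : Fin n → List X) (g : Fin n → X → ℕ) →
                            sumOver (choices n O) (λ s → prodFin n (λ u → g u (s u))) ≡ prodFin n (λ u → sumOver (O u) (g u))
  sumOver-choices-prodFin zero O g = refl
  sumOver-choices-prodFin (suc n) O g = begin
    sumOver (choices (suc n) O) (λ s → prodFin (suc n) (λ u → g u (s u)))
      ≡⟨ sumOver-choices-suc O _ ⟩
    sumOver (O zero) (λ x → sumOver C (λ s → prodFin (suc n) (λ u → g u ((x ◂ s) u))))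
      ≡⟨ sumOver-cong (O zero) (λ x → sumOver-cong C (λ s → prodFin-suc n (λ u → g u ((x ◂ s) u)))) ⟩
    sumOver (O zero) (λ x → sumOver C (λ s → g zero x * rest s))
      ≡⟨ sumOver-cong (O zero) (λ x → sumOver-*ˡ C (g zero x) rest) ⟩
    sumOver (O zero) (λ x → g zero x * sumOver C rest)
      ≡⟨ sumOver-*ʳ (O zero) _ (g zero) ⟩
    sumOver (O zero) (g zero) * sumOver C rest
      ≡⟨ cong (sumOver (O zero) (g zero) *_) (sumOver-choices-prodFin n (O ∘ suc) (g ∘ suc)) ⟩
    sumOver (O zero) (g zero) * prodFin n (λ u → sumOver (O (suc u)) (g (suc u)))
      ≡⟨ sym (prodFin-suc n (λ u → sumOver (O u) (g u))) ⟩
    prodFin (suc n) (λ u → sumOver (O u) (g u)) ∎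
    where
    C = choices n (O ∘ suc)
    rest : (Fin n → X) → ℕ
    rest s = prodFin n (λ u → g (suc u) (s u))

module Loads {X : Set} {m : ℕ} (w : X → Fin m) where

  load : ∀ {n} → (Fin n → X) → Fin m → ℕ
  load {n} s v = sumFin n (λ u → ⟦ w (s u) ≟ v ⟧)

  load-◂ : ∀ {n} (x : X) (s : Fin n → X) (v : Fin m) → load (x ◂ s) v ≡ ⟦ w x ≟ v ⟧ + load s v
  load-◂ {n} x s v = sumFin-suc n (λ u → ⟦ w ((x ◂ s) u) ≟ v ⟧)

  Factors : Set
  Factors = List (Fin m × ℕ)

  evalFactor : ∀ {n} → (Fin n → X) → Fin m × ℕ → ℕ
  evalFactor s (v , c) = load s v + c

  eval : ∀ {n} → Factors → (Fin n → X) → ℕ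
  eval S s = prodOver S (evalFactor s)

  dropConstants : Factors → Factors
  dropConstants = map (λ (v , _) → (v , 0))

  shift : X → Factors → Factors
  shift x = map (λ (v , c) → (v , c + ⟦ w x ≟ v ⟧))

  dropConstants-shift : ∀ x S → dropConstants (shift x S) ≡ dropConstants S
  dropConstants-shift x [] = refl
  dropConstants-shift x (_ ∷ S) = cong (_ ∷_) (dropConstants-shift x S)

  eval-◂ : ∀ {n} (x : X) (s : Fin n → X) S → eval S (x ◂ s) ≡ eval (shift x S) s
  eval-◂ x s [] = refl
  eval-◂ x s ((v , c) ∷ S) = cong₂ _*_ factor (eval-◂ x s S)
    where
    factor : load (x ◂ s) v + c ≡ load s v + (c + ⟦ w x ≟ v ⟧)
    factor = begin
      load (x ◂ s) v + c               ≡⟨ cong (_+ c) (load-◂ x s v) ⟩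
      ⟦ w x ≟ v ⟧ + load s v + c       ≡⟨ cong (_+ c) (+-comm ⟦ w x ≟ v ⟧ _) ⟩
      load s v + ⟦ w x ≟ v ⟧ + c       ≡⟨ +-assoc (load s v) _ c ⟩
      load s v + (⟦ w x ≟ v ⟧ + c)     ≡⟨ cong (load s v +_) (+-comm _ c) ⟩
      load s v + (c + ⟦ w x ≟ v ⟧)     ∎

  eval-split : ∀ {n} (R : Factors) (v : Fin m) (c : ℕ) (T : Factors) (s : Fin n → X) →
               eval (R ++ (v , c) ∷ T) s ≡ eval (R ++ (v , 0) ∷ T) s + c * eval (R ++ T) s
  eval-split R v c T s = begin
    eval (R ++ (v , c) ∷ T) s        ≡⟨ prodOver-++-∷ R (v , c) T _ ⟩
    (load s v + c) * E               ≡⟨ *-distribʳ-+ E (load s v) c ⟩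
    load s v * E + c * E             ≡⟨ cong (λ t → t * E + c * E) (sym (+-identityʳ (load s v))) ⟩
    (load s v + 0) * E + c * E       ≡⟨ cong (_+ c * E) (sym (prodOver-++-∷ R (v , 0) T _)) ⟩
    eval (R ++ (v , 0) ∷ T) s + c * E ∎
    where E = eval (R ++ T) s

  -- Expanding a product of fewer than n factors, every monomial ignores the choice at
  -- some u, and summing over that choice contributes the factor |O u| ≡ 0.  The mutual
  -- induction realises this: a vanishing sum lets one drop constants, and constants are
  -- exactly what separates the inner sums after fixing the first choice.
  module Vanishing (q : ℕ) .{{_ : NonZero q}} where
    open Modulo q

    mutual
      sumOver-eval≈0 : ∀ n (O : Fin n → List X) → (∀ u → q ∣ length (O u)) →
                       (S : Factors) → length S < n → sumOver (choices n O) (eval S) ≈ 0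
      sumOver-eval≈0 (suc n) O q∣O S |S|≤n = begin
        sumOver (choices (suc n) O) (eval S) % q
          ≡⟨ cong (_% q) (sumOver-choices-suc O (eval S)) ⟩
        sumOver (O zero) (λ x → sumOver C (λ s → eval S (x ◂ s))) % q
          ≡⟨ cong (_% q) (sumOver-cong (O zero) (λ x → sumOver-cong C (λ s → eval-◂ x s S))) ⟩
        sumOver (O zero) (λ x → sumOver C (eval (shift x S))) % q
          ≡⟨ sumOver-≈ (O zero) shifted≈ ⟩
        sumOver (O zero) (λ _ → sumOver C (eval (dropConstants S))) % q
          ≡⟨ cong (_% q) (trans (sumOver-const (O zero) _) (*-comm (length (O zero)) _)) ⟩
        (sumOver C (eval (dropConstants S)) * length (O zero)) % q
          ≡⟨ +-*-∣-≈ 0 (sumOver C (eval (dropConstants S))) (q∣O zero) ⟩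
        0 % q ∎
        where
        C = choices n (O ∘ suc)
        shifted≈ : ∀ x → sumOver C (eval (shift x S)) ≈ sumOver C (eval (dropConstants S))
        shifted≈ x = trans (sumOver-eval-dropConstants n (O ∘ suc) (q∣O ∘ suc) [] (shift x S)
                              (subst (_≤ n) (sym (length-map _ S)) (≤-pred |S|≤n)))
                           (cong (λ t → sumOver C (eval t) % q) (dropConstants-shift x S))

      sumOver-eval-dropConstants : ∀ n (O : Fin n → List X) → (∀ u → q ∣ length (O u)) →
                                   (R S : Factors) → length R + length S ≤ n →
                                   sumOver (choices n O) (eval (R ++ S)) ≈ sumOver (choices n O) (eval (R ++ dropConstants S))
      sumOver-eval-dropConstants n O q∣O R [] _ = refl
      sumOver-eval-dropConstants n O q∣O R ((v , c) ∷ T) |R|+|S|≤n = begin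
        sumOver C (eval (R ++ (v , c) ∷ T)) % q
          ≡⟨ cong (_% q) (trans (sumOver-cong C (eval-split R v c T)) (sumOver-+ C _ _)) ⟩
        (sumOver C (eval (R ++ (v , 0) ∷ T)) + sumOver C (λ s → c * eval (R ++ T) s)) % q
          ≡⟨ cong (λ t → (sumOver C (eval (R ++ (v , 0) ∷ T)) + t) % q) (sumOver-*ˡ C c _) ⟩
        (sumOver C (eval (R ++ (v , 0) ∷ T)) + c * sumOver C (eval (R ++ T))) % q
          ≡⟨ +-*-∣-≈ _ c (∣-resp-≈ (sumOver-eval≈0 n O q∣O (R ++ T) |R++T|<n) (divides 0 refl)) ⟩
        sumOver C (eval (R ++ (v , 0) ∷ T)) % q
          ≡⟨ cong (λ t → sumOver C (eval t) % q) (sym (++-assoc R [ (v , 0) ] T)) ⟩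
        sumOver C (eval ((R ++ [ (v , 0) ]) ++ T)) % q
          ≡⟨ sumOver-eval-dropConstants n O q∣O (R ++ [ (v , 0) ]) T |R+v|+|T|≤n ⟩
        sumOver C (eval ((R ++ [ (v , 0) ]) ++ dropConstants T)) % q
          ≡⟨ cong (λ t → sumOver C (eval t) % q) (++-assoc R [ (v , 0) ] (dropConstants T)) ⟩
        sumOver C (eval (R ++ dropConstants ((v , c) ∷ T))) % q ∎
        where
        C = choices n O
        |R++T|<n : length (R ++ T) < n
        |R++T|<n = subst (_< n) (sym (length-++ R)) (subst (_≤ n) (+-suc (length R) (length T)) |R|+|S|≤n)
        |R+v|+|T|≤n : length (R ++ [ (v , 0) ]) + length T ≤ n
        |R+v|+|T|≤n = subst (λ t → t + length T ≤ n) (sym (trans (length-++ R) (+-comm (length R) 1)))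
                        (subst (_≤ n) (+-suc (length R) (length T)) |R|+|S|≤n)

_≟ˢ_ : ∀ {k} → DecidableEquality (Subset k)
_≟ˢ_ = Vecₚ.≡-dec Bool._≟_

sumOver-allSubsets-⟦≟ˢ⟧ : ∀ k (H : Subset k) → sumOver (allSubsets k) (λ H′ → ⟦ H′ ≟ˢ H ⟧) ≡ 1
sumOver-allSubsets-⟦≟ˢ⟧ zero [] = refl
sumOver-allSubsets-⟦≟ˢ⟧ (suc k) (b ∷ H) = begin
  sumOver (map (true ∷_) Hs ++ map (false ∷_) Hs) (λ H′ → ⟦ H′ ≟ˢ (b ∷ H) ⟧)
    ≡⟨ sumOver-++ (map (true ∷_) Hs) _ _ ⟩
  sumOver (map (true ∷_) Hs) (λ H′ → ⟦ H′ ≟ˢ (b ∷ H) ⟧)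
    + sumOver (map (false ∷_) Hs) (λ H′ → ⟦ H′ ≟ˢ (b ∷ H) ⟧)
    ≡⟨ cong₂ _+_ (trans (sumOver-map _ Hs _) (head-fixed true)) (trans (sumOver-map _ Hs _) (head-fixed false)) ⟩
  ⟦ true Bool.≟ b ⟧ * 1 + ⟦ false Bool.≟ b ⟧ * 1
    ≡⟨ one-of b ⟩
  1 ∎
  where
  Hs = allSubsets k
  head-fixed : ∀ c → sumOver Hs (λ H′ → ⟦ (c ∷ H′) ≟ˢ (b ∷ H) ⟧) ≡ ⟦ c Bool.≟ b ⟧ * 1
  head-fixed c = begin
    sumOver Hs (λ H′ → ⟦ (c ∷ H′) ≟ˢ (b ∷ H) ⟧)
      ≡⟨ sumOver-cong Hs (λ H′ → trans (⟦⟧-cong Vecₚ.∷-injective (λ (p , r) → cong₂ _∷_ p r)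
                                                 ((c ∷ H′) ≟ˢ (b ∷ H)) ((c Bool.≟ b) ×-dec (H′ ≟ˢ H)))
                                        (⟦×-dec⟧ (c Bool.≟ b) (H′ ≟ˢ H))) ⟩
    sumOver Hs (λ H′ → ⟦ c Bool.≟ b ⟧ * ⟦ H′ ≟ˢ H ⟧)  ≡⟨ sumOver-*ˡ Hs ⟦ c Bool.≟ b ⟧ _ ⟩
    ⟦ c Bool.≟ b ⟧ * sumOver Hs (λ H′ → ⟦ H′ ≟ˢ H ⟧)  ≡⟨ cong (⟦ c Bool.≟ b ⟧ *_) (sumOver-allSubsets-⟦≟ˢ⟧ k H) ⟩
    ⟦ c Bool.≟ b ⟧ * 1                                ∎
  one-of : ∀ b → ⟦ true Bool.≟ b ⟧ * 1 + ⟦ false Bool.≟ b ⟧ * 1 ≡ 1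
  one-of true = refl
  one-of false = refl

length-filter-∈×≟ : ∀ {k j} (H : Subset k) (g : Fin k → Fin j) (x : Fin j) →
                    length (filter (λ f → (f ∈? H) ×-dec (g f ≟ x)) (allFin k))
                    ≡ sumFin k (λ f → ⟦ f ∈? H ⟧ * ⟦ g f ≟ x ⟧)
length-filter-∈×≟ {k} H g x =
  trans (length-filter≡sumOver _ (allFin k)) (sumOver-cong (allFin k) (λ f → ⟦×-dec⟧ (f ∈? H) (g f ≟ x)))

∈-fullSet : ∀ {k} (f : Fin k) → f ∈ fullSet k
∈-fullSet zero = Vec.here
∈-fullSet (suc f) = Vec.there (∈-fullSet f)

length-filter-fullSet : ∀ {k j} (g : Fin k → Fin j) (x : Fin j) →
                        length (filter (λ f → (f ∈? fullSet k) ×-dec (g f ≟ x)) (allFin k)) ≡ sumFin k (λ f → ⟦ g f ≟ x ⟧)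
length-filter-fullSet {k} g x = trans (length-filter-∈×≟ (fullSet k) g x)
  (sumOver-cong (allFin k) (λ f → trans (cong (_* ⟦ g f ≟ x ⟧) (⟦yes⟧ (f ∈? fullSet k) (∈-fullSet f))) (+-identityʳ _)))

single : (xs : List A) → length xs ≡ 1 → ∃ λ x → xs ≡ [ x ]
single (x ∷ []) _ = x , refl

does-true⇒ : (d : Dec P) → does d ≡ true → P
does-true⇒ (yes p) _ = p

⇒does-true : (d : Dec P) → P → does d ≡ true
⇒does-true (yes p) _ = refl
⇒does-true (no ¬p) p = contradiction p ¬p

⇒does-false : (d : Dec P) → ¬ P → does d ≡ false
⇒does-false (yes p) ¬p = contradiction p ¬p
⇒does-false (no _) _ = refl

module EdgeChoices {n m : ℕ} (G : BipMultigraph n m) where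
  open Loads (vEnd G)

  edgesAt : Fin n → List (Fin (e G))
  edgesAt u = filter (λ f → uEnd G f ≟ u) (allFin (e G))

  edgeChoices : List (Fin n → Fin (e G))
  edgeChoices = choices n edgesAt

  IsEdgeChoice : (Fin n → Fin (e G)) → Set
  IsEdgeChoice s = ∀ u → uEnd G (s u) ≡ u

  edgeChoices-valid : All IsEdgeChoice edgeChoices
  edgeChoices-valid = All-choices n edgesAt (λ u → Allₚ.all-filter (λ f → uEnd G f ≟ u) (allFin (e G)))

  subsetOf : (Fin n → Fin (e G)) → Subset (e G)
  subsetOf s = tabulate (λ f → does (s (uEnd G f) ≟ f))

  ∈-subsetOf⁻ : ∀ s f → f ∈ subsetOf s → s (uEnd G f) ≡ f
  ∈-subsetOf⁻ s f f∈ = does-true⇒ (s (uEnd G f) ≟ f) (trans (sym (Vecₚ.lookup∘tabulate _ f)) (Vecₚ.[]=⇒lookup f∈))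

  ∈-subsetOf⁺ : ∀ s f → s (uEnd G f) ≡ f → f ∈ subsetOf s
  ∈-subsetOf⁺ s f sf≡f =
    Vecₚ.lookup⇒[]= f (subsetOf s) (trans (Vecₚ.lookup∘tabulate _ f) (⇒does-true (s (uEnd G f) ≟ f) sf≡f))

  ⟦∈-subsetOf⟧ : ∀ s f → ⟦ f ∈? subsetOf s ⟧ ≡ ⟦ s (uEnd G f) ≟ f ⟧
  ⟦∈-subsetOf⟧ s f = ⟦⟧-cong (∈-subsetOf⁻ s f) (∈-subsetOf⁺ s f) (f ∈? subsetOf s) (s (uEnd G f) ≟ f)

  degU-subsetOf : ∀ s → IsEdgeChoice s → ∀ u → degU G (subsetOf s) u ≡ 1
  degU-subsetOf s valid u = begin
    degU G (subsetOf s) u                                  ≡⟨ length-filter-∈×≟ (subsetOf s) (uEnd G) u ⟩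
    sumFin (e G) (λ f → ⟦ f ∈? subsetOf s ⟧ * ⟦ uEnd G f ≟ u ⟧) ≡⟨ sumOver-cong (allFin (e G)) chosen ⟩
    sumFin (e G) (λ f → ⟦ s u ≟ f ⟧ * 1)                   ≡⟨ sumFin-select′ (e G) (s u) (λ _ → 1) ⟩
    1                                                      ∎
    where
    chosen : ∀ f → ⟦ f ∈? subsetOf s ⟧ * ⟦ uEnd G f ≟ u ⟧ ≡ ⟦ s u ≟ f ⟧ * 1
    chosen f = begin
      ⟦ f ∈? subsetOf s ⟧ * ⟦ uEnd G f ≟ u ⟧       ≡⟨ cong (_* ⟦ uEnd G f ≟ u ⟧) (⟦∈-subsetOf⟧ s f) ⟩
      ⟦ s (uEnd G f) ≟ f ⟧ * ⟦ uEnd G f ≟ u ⟧      ≡⟨ sym (⟦×-dec⟧ (s (uEnd G f) ≟ f) (uEnd G f ≟ u)) ⟩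
      ⟦ (s (uEnd G f) ≟ f) ×-dec (uEnd G f ≟ u) ⟧
        ≡⟨ ⟦⟧-cong (λ { (sf≡f , refl) → sf≡f }) (λ { refl → cong s (valid u) , valid u })
                   ((s (uEnd G f) ≟ f) ×-dec (uEnd G f ≟ u)) (s u ≟ f) ⟩
      ⟦ s u ≟ f ⟧                                  ≡⟨ sym (*-identityʳ _) ⟩
      ⟦ s u ≟ f ⟧ * 1                              ∎

  degV-subsetOf : ∀ s → IsEdgeChoice s → ∀ v → degV G (subsetOf s) v ≡ load s v
  degV-subsetOf s valid v = begin
    degV G (subsetOf s) v
      ≡⟨ length-filter-∈×≟ (subsetOf s) (vEnd G) v ⟩
    sumFin (e G) (λ f → ⟦ f ∈? subsetOf s ⟧ * ⟦ vEnd G f ≟ v ⟧)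
      ≡⟨ sumOver-cong (allFin (e G)) (λ f → cong (_* ⟦ vEnd G f ≟ v ⟧) (trans (⟦∈-subsetOf⟧ s f) (sym (chosen-once f)))) ⟩
    sumFin (e G) (λ f → sumFin n (λ u → ⟦ s u ≟ f ⟧) * ⟦ vEnd G f ≟ v ⟧)
      ≡⟨ sumOver-cong (allFin (e G)) (λ f → sym (sumOver-*ʳ (allFin n) ⟦ vEnd G f ≟ v ⟧ (λ u → ⟦ s u ≟ f ⟧))) ⟩
    sumFin (e G) (λ f → sumFin n (λ u → ⟦ s u ≟ f ⟧ * ⟦ vEnd G f ≟ v ⟧))
      ≡⟨ sumOver-swap (allFin (e G)) (allFin n) _ ⟩
    sumFin n (λ u → sumFin (e G) (λ f → ⟦ s u ≟ f ⟧ * ⟦ vEnd G f ≟ v ⟧))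
      ≡⟨ sumOver-cong (allFin n) (λ u → sumFin-select′ (e G) (s u) (λ f → ⟦ vEnd G f ≟ v ⟧)) ⟩
    load s v ∎
    where
    chosen-once : ∀ f → sumFin n (λ u → ⟦ s u ≟ f ⟧) ≡ ⟦ s (uEnd G f) ≟ f ⟧
    chosen-once f = begin
      sumFin n (λ u → ⟦ s u ≟ f ⟧)
        ≡⟨ sumOver-cong (allFin n) (λ u → trans (⟦⟧-cong (λ { refl → sym (valid u) , refl }) proj₂
                                                          (s u ≟ f) ((u ≟ uEnd G f) ×-dec (s u ≟ f)))
                                                 (⟦×-dec⟧ (u ≟ uEnd G f) (s u ≟ f))) ⟩
      sumFin n (λ u → ⟦ u ≟ uEnd G f ⟧ * ⟦ s u ≟ f ⟧) ≡⟨ sumFin-select n (uEnd G f) (λ u → ⟦ s u ≟ f ⟧) ⟩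
      ⟦ s (uEnd G f) ≟ f ⟧ ∎

  module _ (H : Subset (e G)) (degU≡1 : ∀ u → degU G H u ≡ 1) where

    private
      edgesOfHAt : Fin n → List (Fin (e G))
      edgesOfHAt u = filter (λ f → (f ∈? H) ×-dec (uEnd G f ≟ u)) (allFin (e G))

    edgeAt : Fin n → Fin (e G)
    edgeAt u = proj₁ (single (edgesOfHAt u) (degU≡1 u))

    edgeAt-∈ : ∀ u → edgeAt u ∈ H × uEnd G (edgeAt u) ≡ u
    edgeAt-∈ u = proj₂ (Listₚ.∈-filter⁻ (λ f → (f ∈? H) ×-dec (uEnd G f ≟ u)) {xs = allFin (e G)}
                   (subst (edgeAt u List.∈_) (sym (proj₂ (single (edgesOfHAt u) (degU≡1 u)))) (here refl)))

    edgeAt-unique : ∀ u f → f ∈ H → uEnd G f ≡ u → f ≡ edgeAt u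
    edgeAt-unique u f f∈H end≡u
      with subst (f List.∈_) (proj₂ (single (edgesOfHAt u) (degU≡1 u)))
                 (Listₚ.∈-filter⁺ (λ f → (f ∈? H) ×-dec (uEnd G f ≟ u)) (Listₚ.∈-allFin f) (f∈H , end≡u))
    ... | here f≡edge = f≡edge

    H≡subsetOf⇒ : ∀ s → H ≡ subsetOf s → ∀ u → s u ≡ edgeAt u
    H≡subsetOf⇒ s H≡ u = begin
      s u                      ≡⟨ cong s (sym (proj₂ (edgeAt-∈ u))) ⟩
      s (uEnd G (edgeAt u))    ≡⟨ ∈-subsetOf⁻ s (edgeAt u) (subst (edgeAt u ∈_) H≡ (proj₁ (edgeAt-∈ u))) ⟩
      edgeAt u                 ∎

    ⇒H≡subsetOf : ∀ s → (∀ u → s u ≡ edgeAt u) → H ≡ subsetOf s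
    ⇒H≡subsetOf s s≡ = trans (sym (Vecₚ.tabulate∘lookup H)) (Vecₚ.tabulate-cong pointwise)
      where
      pointwise : ∀ f → lookup H f ≡ does (s (uEnd G f) ≟ f)
      pointwise f with lookup H f in Hf
      ... | true = sym (⇒does-true (s (uEnd G f) ≟ f)
                         (trans (s≡ (uEnd G f)) (sym (edgeAt-unique (uEnd G f) f (Vecₚ.lookup⇒[]= f H Hf) refl))))
      ... | false = sym (⇒does-false (s (uEnd G f) ≟ f) f∉)
        where
        f∉ : s (uEnd G f) ≢ f
        f∉ sf≡f
          with trans (sym Hf) (Vecₚ.[]=⇒lookup (subst (_∈ H) (trans (sym (s≡ (uEnd G f))) sf≡f) (proj₁ (edgeAt-∈ (uEnd G f)))))
        ... | ()

    unique-edgeChoice : sumOver edgeChoices (λ s → ⟦ H ≟ˢ subsetOf s ⟧) ≡ 1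
    unique-edgeChoice = begin
      sumOver edgeChoices (λ s → ⟦ H ≟ˢ subsetOf s ⟧)
        ≡⟨ sumOver-cong edgeChoices (λ s →
             trans (⟦⟧-cong (H≡subsetOf⇒ s) (⇒H≡subsetOf s) (H ≟ˢ subsetOf s) (all? (λ u → s u ≟ edgeAt u)))
                   (sym (prodFin-⟦⟧ n (λ u → s u ≟ edgeAt u)))) ⟩
      sumOver edgeChoices (λ s → prodFin n (λ u → ⟦ s u ≟ edgeAt u ⟧))
        ≡⟨ sumOver-choices-prodFin n edgesAt (λ u x → ⟦ x ≟ edgeAt u ⟧) ⟩
      prodFin n (λ u → sumOver (edgesAt u) (λ x → ⟦ x ≟ edgeAt u ⟧))
        ≡⟨ prodOver-cong (allFin n) edgeAt-once ⟩
      prodFin n (λ _ → 1)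
        ≡⟨ prodOver-one (allFin n) ⟩
      1 ∎
      where
      edgeAt-once : ∀ u → sumOver (edgesAt u) (λ x → ⟦ x ≟ edgeAt u ⟧) ≡ 1
      edgeAt-once u = begin
        sumOver (edgesAt u) (λ x → ⟦ x ≟ edgeAt u ⟧)
          ≡⟨ sumOver-filter (λ f → uEnd G f ≟ u) (allFin (e G)) _ ⟩
        sumFin (e G) (λ x → ⟦ uEnd G x ≟ u ⟧ * ⟦ x ≟ edgeAt u ⟧)
          ≡⟨ sumOver-cong (allFin (e G)) (λ x → *-comm ⟦ uEnd G x ≟ u ⟧ _) ⟩
        sumFin (e G) (λ x → ⟦ x ≟ edgeAt u ⟧ * ⟦ uEnd G x ≟ u ⟧)
          ≡⟨ sumFin-select (e G) (edgeAt u) (λ x → ⟦ uEnd G x ≟ u ⟧) ⟩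
        ⟦ uEnd G (edgeAt u) ≟ u ⟧
          ≡⟨ ⟦yes⟧ (uEnd G (edgeAt u) ≟ u) (proj₂ (edgeAt-∈ u)) ⟩
        1 ∎

  pm≡sumOver-edgeChoices : pm G ≡ sumOver edgeChoices (λ s → ⟦ all? (λ v → load s v ℕ.≟ 1) ⟧)
  pm≡sumOver-edgeChoices = begin
    pm G
      ≡⟨ length-filter≡sumOver (isPM? G) (allSubsets (e G)) ⟩
    sumOver (allSubsets (e G)) (λ H → ⟦ isPM? G H ⟧)
      ≡⟨ sumOver-cong (allSubsets (e G)) (λ H → ⟦×-dec⟧ (allU? H) (allV? H)) ⟩
    sumOver (allSubsets (e G)) (λ H → ⟦ allU? H ⟧ * ⟦ allV? H ⟧)
      ≡⟨ sumOver-reindex allU? _≟ˢ_ (allSubsets (e G)) edgeChoices subsetOf (λ H → ⟦ allV? H ⟧) unique-edgeChoice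
           (All.map (λ {s} valid → degU-subsetOf s valid , sumOver-allSubsets-⟦≟ˢ⟧ (e G) (subsetOf s)) edgeChoices-valid) ⟩
    sumOver edgeChoices (λ s → ⟦ allV? (subsetOf s) ⟧)
      ≡⟨ sumOver-congᴬ edgeChoices edgeChoices-valid (λ s valid →
           ⟦⟧-cong (λ deg≡1 v → trans (sym (degV-subsetOf s valid v)) (deg≡1 v))
                   (λ load≡1 v → trans (degV-subsetOf s valid v) (load≡1 v))
                   (allV? (subsetOf s)) (all? (λ v → load s v ℕ.≟ 1))) ⟩
    sumOver edgeChoices (λ s → ⟦ all? (λ v → load s v ℕ.≟ 1) ⟧) ∎
    where
    allU? : (H : Subset (e G)) → Dec (∀ u → degU G H u ≡ 1)
    allU? H = all? (λ u → degU G H u ℕ.≟ 1)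
    allV? : (H : Subset (e G)) → Dec (∀ v → degV G H v ≡ 1)
    allV? H = all? (λ v → degV G H v ℕ.≟ 1)

module Regular {n m : ℕ} (G : BipMultigraph n m) {q : ℕ} .{{_ : NonZero q}} (regular : IsRegular G q) where
  open EdgeChoices G

  length-edgesAt : ∀ u → length (edgesAt u) ≡ q
  length-edgesAt u = begin
    length (edgesAt u)                        ≡⟨ length-filter≡sumOver (λ f → uEnd G f ≟ u) (allFin (e G)) ⟩
    sumFin (e G) (λ f → ⟦ uEnd G f ≟ u ⟧)     ≡⟨ sym (length-filter-fullSet (uEnd G) u) ⟩
    degU G (fullSet (e G)) u                  ≡⟨ proj₁ regular u ⟩
    q                                         ∎

  size*q≡e : ∀ {k} (end : Fin (e G) → Fin k) → (∀ x → sumFin (e G) (λ f → ⟦ end f ≟ x ⟧) ≡ q) → k * q ≡ e G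
  size*q≡e {k} end deg≡q = trans (sym (sumFin-const k q)) (trans (sumOver-cong (allFin k) (sym ∘ deg≡q)) (sumFin-fibres k end))

  n≡m : n ≡ m
  n≡m = *-cancelʳ-≡ n m q (trans (size*q≡e (uEnd G) (λ u → trans (sym (length-filter-fullSet (uEnd G) u)) (proj₁ regular u)))
                           (sym (size*q≡e (vEnd G) (λ v → trans (sym (length-filter-fullSet (vEnd G) v)) (proj₂ regular v)))))

module _ {n m : ℕ} (G : BipMultigraph n m) {q : ℕ} .{{_ : NonZero q}} (regular : IsRegular G q) (α : Fin m → Fin q) where
  open EdgeChoices G
  open Loads (vEnd G)
  open Regular G regular
  open Modulo q
  open Vanishing q

  -- q ∸ α v is an additive inverse of α v modulo q, so q divides the factor for v
  -- exactly when the load of v is α v modulo q.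
  negα : Fin m → ℕ
  negα v = q ∸ toℕ (α v)

  factorsα : Factors
  factorsα = map (λ v → (v , negα v)) (allFin m)

  Avoids : (Fin n → Fin (e G)) → Set
  Avoids s = ∀ v → ¬ (q ∣ load s v + negα v)

  avoids? : ∀ s → Dec (Avoids s)
  avoids? s = all? (λ v → ¬? (q ∣? (load s v + negα v)))

  eval-factorsα : (s : Fin n → Fin (e G)) → eval factorsα s ≡ prodFin m (λ v → load s v + negα v)
  eval-factorsα s = prodOver-map (λ v → (v , negα v)) (allFin m) (evalFactor s)

  eval-dropConstants-factorsα : (s : Fin n → Fin (e G)) → eval (dropConstants factorsα) s ≡ ⟦ all? (λ v → load s v ℕ.≟ 1) ⟧
  eval-dropConstants-factorsα s = begin
    eval (dropConstants factorsα) s                ≡⟨ trans (prodOver-map _ factorsα (evalFactor s)) (prodOver-map _ (allFin m) _) ⟩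
    prodFin m (λ v → load s v + 0)                 ≡⟨ prodOver-cong (allFin m) (λ v → +-identityʳ (load s v)) ⟩
    prodFin m (load s)                             ≡⟨ prodFin≡⟦all≡1⟧ m (load s) (trans (sumFin-fibres m (vEnd G ∘ s)) n≡m) ⟩
    ⟦ all? (λ v → load s v ℕ.≟ 1) ⟧                ∎

  pm≈sumOver-eval-factorsα : pm G ≈ sumOver edgeChoices (eval factorsα)
  pm≈sumOver-eval-factorsα = begin
    pm G % q                                                   ≡⟨ cong (_% q) pm≡sumOver-edgeChoices ⟩
    sumOver edgeChoices (λ s → ⟦ all? (λ v → load s v ℕ.≟ 1) ⟧) % q
      ≡⟨ cong (_% q) (sumOver-cong edgeChoices (sym ∘ eval-dropConstants-factorsα)) ⟩
    sumOver edgeChoices (eval (dropConstants factorsα)) % q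
      ≡⟨ sym (sumOver-eval-dropConstants n edgesAt q∣edgesAt [] factorsα |factorsα|≤n) ⟩
    sumOver edgeChoices (eval factorsα) % q                    ∎
    where
    q∣edgesAt : ∀ u → q ∣ length (edgesAt u)
    q∣edgesAt u = subst (q ∣_) (sym (length-edgesAt u)) (∣-refl {q})
    |factorsα|≤n : length factorsα ≤ n
    |factorsα|≤n = ≤-reflexive (trans (length-map _ (allFin m)) (trans (length-tabulate {n = m} (λ i → i)) (sym n≡m)))

  q∣pm-if-none-avoids : All (¬_ ∘ Avoids) edgeChoices → q ∣ pm G
  q∣pm-if-none-avoids none = ∣-resp-≈ pm≈sumOver-eval-factorsα (∣-sumOver edgeChoices (eval factorsα) (All.map q∣eval none))
    where
    q∣eval : ∀ {s} → ¬ Avoids s → q ∣ eval factorsα s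
    q∣eval {s} ¬avoids with ¬∀⟶∃¬ m _ (λ v → ¬? (q ∣? (load s v + negα v))) ¬avoids
    ... | v , ¬¬q∣ = subst (q ∣_) (sym (eval-factorsα s))
                       (∣-prodFin m (λ v → load s v + negα v) v (decidable-stable (q ∣? (load s v + negα v)) ¬¬q∣))

  avoiding-subgraph : ¬ (q ∣ pm G) →
                      Σ (Subset (e G)) λ H → (∀ u → degU G H u ≡ 1) × (∀ v → ¬ (degV G H v ≡ toℕ (α v) [mod q ]))
  avoiding-subgraph q∤pm with any? avoids? edgeChoices
  ... | yes some with List.find some
  ...   | s , s∈ , avoids = subsetOf s , degU-subsetOf s valid , λ v deg≡α →
            avoids v (∣+∸⇐≡[mod] (load s v) (toℕ (α v)) (toℕ<n (α v))
                                  (subst (_≡ toℕ (α v) [mod q ]) (degV-subsetOf s valid v) deg≡α))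
    where valid = All.lookup edgeChoices-valid s∈
  avoiding-subgraph q∤pm | no none = contradiction (q∣pm-if-none-avoids (Allₚ.¬Any⇒All¬ edgeChoices none)) q∤pm

theorem3 : (q : ℕ) → IsPrimePower q →
    {n m : ℕ} (G : BipMultigraph n m) → IsRegular G q →
    (α : Fin m → Fin q) →
    ¬ (q ∣ pm G) →
    Σ (Subset (e G)) λ H →
      ((u : Fin n) → degU G H u ≡ 1) ×
      ((v : Fin m) → ¬ (degV G H v ≡ toℕ (α v) [mod q ]))
theorem3 q (p , k , p-prime , refl) G regular = avoiding-subgraph G {{m^n≢0 p (suc k) {{prime⇒nonZero p-prime}}}} regular
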